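{- Let $k\ge1$ and $n\ge2$. Let $u_1,\ldots,u_n$ be non-empty words over $\{0,1\}$ and $i_1,\ldots,i_n$ integers, all greater than or equal to $k$ except exactly one, $i_r$, which equals $k-1$. Then for every permutation $\nu$ of $\{1,\ldots,n\}$ and all words $u_1',\ldots,u_n'$ with $|u_i'|=|u_i|$ for all $i$ and $u_r'=u_r$, $$\varphi^{i_1}(u_1)\varphi^{i_2}(u_2)\cdots\varphi^{i_n}(u_n)\sim_k\varphi^{i_{\nu(1)}}(u'_{\nu(1)})\varphi^{i_{\nu(2)}}(u'_{\nu(2)})\cdots\varphi^{i_{\nu(n)}}(u'_{\nu(n)}).$$
   Context: $\varphi(0)=01$, $\varphi(1)=10$. $\binom{x}{y}$ is the number of occurrences of $y$ as a subword (subsequence) of $x$; $x\sim_k y$ means $\binom{x}{z}=\binom{y}{z}$ for all words $z$ of length at most $k$. -}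

module Defs where

open import Data.Bool using (Bool; true; false)
open import Data.Nat using (ℕ; zero; suc; _+_; _*_; _≤_)
open import Data.List using (List; []; _∷_; _++_; length; concatMap; concat; map)
open import Data.Fin using (Fin)
open import Data.List using (allFin)
open import Relation.Binary.PropositionalEquality using (_≡_)
open import Relation.Nullary using (yes; no)
open import Data.Bool using (_≟_)

-- Binary words: 0 is false, 1 is true.
Word : Set
Word = List Bool

φ₁ : Bool → Word
φ₁ false = false ∷ true ∷ []
φ₁ true  = true ∷ false ∷ []

φ : Word → Word
φ = concatMap φ₁

φ^ : ℕ → Word → Word
φ^ zero    w = w
φ^ (suc i) w = φ (φ^ i w)

-- Binomial coefficient of words: number of occurrences of y as a
-- (scattered) subword of x.
binom : Word → Word → ℕ
binom x        []       = 1
binom []       (b ∷ y)  = 0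
binom (a ∷ x)  (b ∷ y) with a ≟ b
... | yes _ = binom x y + binom x (b ∷ y)
... | no  _ = binom x (b ∷ y)

_∼[_]_ : Word → ℕ → Word → Set
x ∼[ k ] y = (z : Word) → length z ≤ k → binom x z ≡ binom y z

concatFin : {n : ℕ} → (Fin n → Word) → Word
concatFin {n} w = concat (map w (allFin n))

-- Put m = k − 1. Every exponent is at least m (i_r = m, the others exceed it), so the
-- two sides are φ^m(W) and φ^m(W′) for suitable words W, W′. If A ∼_j B then
-- AB ∼_{j+1} BA: expanding the coefficients of AB and BA over the factorisations z = pq,
-- the terms with p, q ≠ ε match by A ∼_j B and the remaining two terms are the same on
-- both sides. Since φ^{m+1}(0) = φ^m(01), induction gives φ^m(0) ∼_m φ^m(1) and
-- φ^m(01) ∼_{m+1} φ^m(10); hence φ^m(W) ∼_{m+1} φ^m(W′) whenever W′ is a permutation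
-- of W, i.e. has as many 0s and 1s. The blocks of W and W′ are φ^{i_j−m}(u_j) and
-- φ^{i_j−m}(u′_j); for j ≠ r each letter occurs |φ^{i_j−m−1}(u_j)| times in them, which
-- depends only on |u_j|, and for j = r they coincide.
module Submission where

open import Defs
open import Algebra.Properties.CommutativeMonoid.Sum using (sum; sum-permute; sum-cong-≗)
open import Algebra.Properties.CommutativeSemigroup using (interchange)
open import Data.Bool as Bool using (Bool; true; false)
open import Data.Fin as Fin using (Fin)
open import Data.Fin.Permutation using (Permutation′; _⟨$⟩ʳ_)
open import Data.List using ([]; _∷_; _++_; [_]; length; concat; filter; replicate; allFin)
open import Data.List.Properties using (++-assoc; length-++; filter-++; map-cong; map-tabulate)
open import Data.List.Relation.Binary.Permutation.Propositional as ↭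
  using (_↭_; ↭-sym; ↭-reflexive)
open import Data.List.Relation.Binary.Permutation.Propositional.Properties using (shift)
open import Data.Nat using (ℕ; zero; suc; _+_; _*_; _∸_; _≤_; _<_; z≤n; s≤s)
open import Data.Nat.Properties
  using ( ≤-refl; ≤-trans; ≤-reflexive; <⇒≤; m≤n⇒m≤1+n; m<n⇒0<n∸m; m+[n∸m]≡n
        ; +-suc; *-distribʳ-+; +-0-commutativeMonoid; +-commutativeSemigroup)
open import Data.Nat.Tactic.RingSolver using (solve-∀)
open import Function using (_∘_; id)
open import Relation.Binary.Bundles using (Setoid)
open import Relation.Binary.Structures using (IsEquivalence)
open import Relation.Binary.PropositionalEquality
  using (_≡_; _≢_; refl; sym; trans; cong; cong₂; module ≡-Reasoning)
import Relation.Binary.Reasoning.Setoid as SetoidReasoning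
open import Relation.Nullary using (yes; no)

-- ∑ f p · g s over the factorisations z = p s with s ≠ [].
conv : (Word → ℕ) → (Word → ℕ) → Word → ℕ
conv f g []      = 0
conv f g (c ∷ z) = f [] * g (c ∷ z) + conv (f ∘ (c ∷_)) g z

conv-cong : ∀ {f f′ g g′} z →
  (∀ p → length p < length z → f p ≡ f′ p) →
  (∀ s → length s ≤ length z → g s ≡ g′ s) →
  conv f g z ≡ conv f′ g′ z
conv-cong []      f≡f′ g≡g′ = refl
conv-cong (c ∷ z) f≡f′ g≡g′ = cong₂ _+_
  (cong₂ _*_ (f≡f′ [] (s≤s z≤n)) (g≡g′ (c ∷ z) ≤-refl))
  (conv-cong z (λ p → f≡f′ (c ∷ p) ∘ s≤s) (λ s → g≡g′ s ∘ m≤n⇒m≤1+n))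

conv-zeroˡ : ∀ g z → conv (λ _ → 0) g z ≡ 0
conv-zeroˡ g []      = refl
conv-zeroˡ g (c ∷ z) = conv-zeroˡ g z

conv-+ˡ : ∀ f f′ g z → conv (λ p → f p + f′ p) g z ≡ conv f g z + conv f′ g z
conv-+ˡ f f′ g []      = refl
conv-+ˡ f f′ g (c ∷ z) = trans
  (cong₂ _+_ (*-distribʳ-+ (g (c ∷ z)) (f []) (f′ [])) (conv-+ˡ (f ∘ (c ∷_)) (f′ ∘ (c ∷_)) g z))
  (interchange +-commutativeSemigroup (f [] * g (c ∷ z)) (f′ [] * g (c ∷ z)) _ _)

binom-++ : ∀ x y z → binom (x ++ y) z ≡ conv (binom x) (binom y) z + binom x z
binom-++ x        y []      = refl
binom-++ []       y (c ∷ z) = begin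
    binom y (c ∷ z)
  ≡⟨ unit (binom y (c ∷ z)) ⟨
    (1 * binom y (c ∷ z) + 0) + 0
  ≡⟨ cong (λ q → (1 * binom y (c ∷ z) + q) + 0) (conv-zeroˡ (binom y) z) ⟨
    (1 * binom y (c ∷ z) + conv (λ _ → 0) (binom y) z) + 0
  ∎
  where
  open ≡-Reasoning
  unit : ∀ b → (1 * b + 0) + 0 ≡ b
  unit = solve-∀
binom-++ (a ∷ x) y (c ∷ z) with a Bool.≟ c
... | yes refl = begin
    binom (x ++ y) z + binom (x ++ y) (a ∷ z)
  ≡⟨ cong₂ _+_ (binom-++ x y z) (binom-++ x y (a ∷ z)) ⟩
    (conv bx by z + bx z) + ((1 * by (a ∷ z) + conv (bx ∘ (a ∷_)) by z) + bx (a ∷ z))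
  ≡⟨ regroup (conv bx by z) (bx z) (1 * by (a ∷ z)) _ (bx (a ∷ z)) ⟩
    (1 * by (a ∷ z) + (conv bx by z + conv (bx ∘ (a ∷_)) by z)) + (bx z + bx (a ∷ z))
  ≡⟨ cong (λ q → (1 * by (a ∷ z) + q) + (bx z + bx (a ∷ z))) (conv-+ˡ bx (bx ∘ (a ∷_)) by z) ⟨
    (1 * by (a ∷ z) + conv (λ p → bx p + bx (a ∷ p)) by z) + (bx z + bx (a ∷ z))
  ∎
  where
  open ≡-Reasoning
  bx = binom x
  by = binom y
  regroup : ∀ p q r s t → (p + q) + ((r + s) + t) ≡ (r + (p + s)) + (q + t)
  regroup = solve-∀
... | no _ = binom-++ x y (c ∷ z)

∼-refl : ∀ {k x} → x ∼[ k ] x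
∼-refl z _ = refl

∼-sym : ∀ {k x y} → x ∼[ k ] y → y ∼[ k ] x
∼-sym x∼y z |z|≤k = sym (x∼y z |z|≤k)

∼-trans : ∀ {k x y w} → x ∼[ k ] y → y ∼[ k ] w → x ∼[ k ] w
∼-trans x∼y y∼w z |z|≤k = trans (x∼y z |z|≤k) (y∼w z |z|≤k)

∼-isEquivalence : ∀ k → IsEquivalence (_∼[ k ]_)
∼-isEquivalence k = record { refl = ∼-refl ; sym = ∼-sym ; trans = ∼-trans }

∼-setoid : ℕ → Setoid _ _
∼-setoid k = record { isEquivalence = ∼-isEquivalence k }

module ∼-Reasoning (k : ℕ) = SetoidReasoning (∼-setoid k)

∼-++ : ∀ {k x x′ y y′} → x ∼[ k ] x′ → y ∼[ k ] y′ → (x ++ y) ∼[ k ] (x′ ++ y′)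
∼-++ {x = x} {x′} {y} {y′} x∼x′ y∼y′ z |z|≤k = begin
    binom (x ++ y) z
  ≡⟨ binom-++ x y z ⟩
    conv (binom x) (binom y) z + binom x z
  ≡⟨ cong₂ _+_
       (conv-cong z (λ p l → x∼x′ p (≤-trans (<⇒≤ l) |z|≤k)) (λ s l → y∼y′ s (≤-trans l |z|≤k)))
       (x∼x′ z |z|≤k) ⟩
    conv (binom x′) (binom y′) z + binom x′ z
  ≡⟨ binom-++ x′ y′ z ⟨
    binom (x′ ++ y′) z
  ∎
  where open ≡-Reasoning

++-comm-∼ : ∀ {j} A B → A ∼[ j ] B → (A ++ B) ∼[ suc j ] (B ++ A)
++-comm-∼ A B A∼B []      _            = refl
++-comm-∼ A B A∼B (c ∷ z) (s≤s |z|≤j) = begin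
    binom (A ++ B) (c ∷ z)
  ≡⟨ binom-++ A B (c ∷ z) ⟩
    (1 * binom B (c ∷ z) + conv (binom A ∘ (c ∷_)) (binom B) z) + binom A (c ∷ z)
  ≡⟨ cong (λ q → (1 * binom B (c ∷ z) + q) + binom A (c ∷ z))
       (conv-cong z (λ p l → A∼B (c ∷ p) (≤-trans l |z|≤j))
                    (λ s l → sym (A∼B s (≤-trans l |z|≤j)))) ⟩
    (1 * binom B (c ∷ z) + conv (binom B ∘ (c ∷_)) (binom A) z) + binom A (c ∷ z)
  ≡⟨ swap-ends (binom B (c ∷ z)) _ (binom A (c ∷ z)) ⟩
    (1 * binom A (c ∷ z) + conv (binom B ∘ (c ∷_)) (binom A) z) + binom B (c ∷ z)
  ≡⟨ binom-++ B A (c ∷ z) ⟨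
    binom (B ++ A) (c ∷ z)
  ∎
  where
  open ≡-Reasoning
  swap-ends : ∀ b m a → (1 * b + m) + a ≡ (1 * a + m) + b
  swap-ends = solve-∀

φ-++ : ∀ x y → φ (x ++ y) ≡ φ x ++ φ y
φ-++ []      y = refl
φ-++ (a ∷ x) y = trans (cong (φ₁ a ++_) (φ-++ x y)) (sym (++-assoc (φ₁ a) (φ x) (φ y)))

φ^-++ : ∀ m x y → φ^ m (x ++ y) ≡ φ^ m x ++ φ^ m y
φ^-++ zero    x y = refl
φ^-++ (suc m) x y = trans (cong φ (φ^-++ m x y)) (φ-++ (φ^ m x) (φ^ m y))

φ^-[] : ∀ m → φ^ m [] ≡ []
φ^-[] zero    = refl
φ^-[] (suc m) = cong φ (φ^-[] m)

φ^-+ : ∀ m t w → φ^ (m + t) w ≡ φ^ m (φ^ t w)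
φ^-+ zero    t w = refl
φ^-+ (suc m) t w = cong φ (φ^-+ m t w)

φ^-suc : ∀ m w → φ^ (suc m) w ≡ φ^ m (φ w)
φ^-suc zero    w = refl
φ^-suc (suc m) w = cong φ (φ^-suc m w)

φ^-∸ : ∀ {m i} w → m ≤ i → φ^ i w ≡ φ^ m (φ^ (i ∸ m) w)
φ^-∸ {m} {i} w m≤i = trans (cong (λ q → φ^ q w) (sym (m+[n∸m]≡n m≤i))) (φ^-+ m (i ∸ m) w)

φ^-0∼φ^-1 : ∀ m → φ^ m [ false ] ∼[ m ] φ^ m [ true ]
φ^-01∼φ^-10 : ∀ m → φ^ m (false ∷ true ∷ []) ∼[ suc m ] φ^ m (true ∷ false ∷ [])

φ^-0∼φ^-1 zero    []      _  = refl
φ^-0∼φ^-1 zero    (_ ∷ _) ()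
φ^-0∼φ^-1 (suc m) = begin
  φ^ (suc m) [ false ]      ≡⟨ φ^-suc m [ false ] ⟩
  φ^ m (false ∷ true ∷ [])  ≈⟨ φ^-01∼φ^-10 m ⟩
  φ^ m (true ∷ false ∷ [])  ≡⟨ φ^-suc m [ true ] ⟨
  φ^ (suc m) [ true ]       ∎
  where open ∼-Reasoning (suc m)

φ^-01∼φ^-10 m = begin
  φ^ m (false ∷ true ∷ [])          ≡⟨ φ^-++ m [ false ] [ true ] ⟩
  φ^ m [ false ] ++ φ^ m [ true ]   ≈⟨ ++-comm-∼ _ _ (φ^-0∼φ^-1 m) ⟩
  φ^ m [ true ] ++ φ^ m [ false ]   ≡⟨ φ^-++ m [ true ] [ false ] ⟨
  φ^ m (true ∷ false ∷ [])          ∎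
  where open ∼-Reasoning (suc m)

φ^-pair-comm : ∀ m a b → φ^ m (a ∷ b ∷ []) ∼[ suc m ] φ^ m (b ∷ a ∷ [])
φ^-pair-comm m false false = ∼-refl
φ^-pair-comm m false true  = φ^-01∼φ^-10 m
φ^-pair-comm m true  false = ∼-sym (φ^-01∼φ^-10 m)
φ^-pair-comm m true  true  = ∼-refl

φ^-↭ : ∀ m {W W′} → W ↭ W′ → φ^ m W ∼[ suc m ] φ^ m W′
φ^-↭ m ↭.refl                = ∼-refl
φ^-↭ m (↭.prep {W} {W′} x p) = begin
  φ^ m (x ∷ W)             ≡⟨ φ^-++ m [ x ] W ⟩
  φ^ m [ x ] ++ φ^ m W     ≈⟨ ∼-++ ∼-refl (φ^-↭ m p) ⟩
  φ^ m [ x ] ++ φ^ m W′    ≡⟨ φ^-++ m [ x ] W′ ⟨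
  φ^ m (x ∷ W′)            ∎
  where open ∼-Reasoning (suc m)
φ^-↭ m (↭.swap {W} {W′} x y p) = begin
  φ^ m (x ∷ y ∷ W)                   ≡⟨ φ^-++ m (x ∷ y ∷ []) W ⟩
  φ^ m (x ∷ y ∷ []) ++ φ^ m W        ≈⟨ ∼-++ (φ^-pair-comm m x y) (φ^-↭ m p) ⟩
  φ^ m (y ∷ x ∷ []) ++ φ^ m W′       ≡⟨ φ^-++ m (y ∷ x ∷ []) W′ ⟨
  φ^ m (y ∷ x ∷ W′)                  ∎
  where open ∼-Reasoning (suc m)
φ^-↭ m (↭.trans p q)         = ∼-trans (φ^-↭ m p) (φ^-↭ m q)

count : Bool → Word → ℕ
count b = length ∘ filter (b Bool.≟_)

count-++ : ∀ b x y → count b (x ++ y) ≡ count b x + count b y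
count-++ b x y =
  trans (cong length (filter-++ (b Bool.≟_) x y)) (length-++ (filter (b Bool.≟_) x))

↭-sorted : ∀ w → w ↭ replicate (count false w) false ++ replicate (count true w) true
↭-sorted []          = ↭.refl
↭-sorted (false ∷ w) = ↭.prep false (↭-sorted w)
↭-sorted (true ∷ w)  =
  ↭.trans (↭.prep true (↭-sorted w)) (↭-sym (shift true (replicate (count false w) false) _))

≡-counts⇒↭ : ∀ {w w′} → (∀ b → count b w ≡ count b w′) → w ↭ w′
≡-counts⇒↭ {w} {w′} counts = ↭.trans (↭-sorted w) (↭.trans
  (↭-reflexive (cong₂ (λ p q → replicate p false ++ replicate q true) (counts false) (counts true)))
  (↭-sym (↭-sorted w′)))

count-φ : ∀ b w → count b (φ w) ≡ length w
count-φ false []          = refl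
count-φ true  []          = refl
count-φ false (false ∷ w) = cong suc (count-φ false w)
count-φ false (true ∷ w)  = cong suc (count-φ false w)
count-φ true  (false ∷ w) = cong suc (count-φ true w)
count-φ true  (true ∷ w)  = cong suc (count-φ true w)

length-φ : ∀ w → length (φ w) ≡ length w + length w
length-φ []          = refl
length-φ (false ∷ w) = cong suc (trans (cong suc (length-φ w)) (sym (+-suc (length w) (length w))))
length-φ (true ∷ w)  = cong suc (trans (cong suc (length-φ w)) (sym (+-suc (length w) (length w))))

length-φ^-cong : ∀ s {v v′} → length v ≡ length v′ → length (φ^ s v) ≡ length (φ^ s v′)
length-φ^-cong zero    eq = eq
length-φ^-cong (suc s) {v} {v′} eq = begin
  length (φ (φ^ s v))                       ≡⟨ length-φ (φ^ s v) ⟩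
  length (φ^ s v) + length (φ^ s v)         ≡⟨ cong₂ _+_ ih ih ⟩
  length (φ^ s v′) + length (φ^ s v′)       ≡⟨ length-φ (φ^ s v′) ⟨
  length (φ (φ^ s v′))                      ∎
  where
  open ≡-Reasoning
  ih = length-φ^-cong s eq

count-φ^-cong : ∀ b {s v v′} → 0 < s → length v ≡ length v′ →
  count b (φ^ s v) ≡ count b (φ^ s v′)
count-φ^-cong b {suc s} {v} {v′} _ eq = begin
  count b (φ (φ^ s v))   ≡⟨ count-φ b (φ^ s v) ⟩
  length (φ^ s v)        ≡⟨ length-φ^-cong s eq ⟩
  length (φ^ s v′)       ≡⟨ count-φ b (φ^ s v′) ⟨
  count b (φ (φ^ s v′))  ∎
  where open ≡-Reasoning

concatFin-suc : ∀ {n} (w : Fin (suc n) → Word) →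
  concatFin w ≡ w Fin.zero ++ concatFin (w ∘ Fin.suc)
concatFin-suc w = cong (λ ws → w Fin.zero ++ concat ws)
  (trans (map-tabulate Fin.suc w) (sym (map-tabulate id (w ∘ Fin.suc))))

concatFin-cong : ∀ {n} {w w′ : Fin n → Word} → (∀ j → w j ≡ w′ j) → concatFin w ≡ concatFin w′
concatFin-cong {n} w≡w′ = cong concat (map-cong w≡w′ (allFin n))

φ^-concatFin : ∀ m {n} (w : Fin n → Word) → φ^ m (concatFin w) ≡ concatFin (φ^ m ∘ w)
φ^-concatFin m {zero}  w = φ^-[] m
φ^-concatFin m {suc n} w = begin
    φ^ m (concatFin w)
  ≡⟨ cong (φ^ m) (concatFin-suc w) ⟩
    φ^ m (w Fin.zero ++ concatFin (w ∘ Fin.suc))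
  ≡⟨ φ^-++ m (w Fin.zero) _ ⟩
    φ^ m (w Fin.zero) ++ φ^ m (concatFin (w ∘ Fin.suc))
  ≡⟨ cong (φ^ m (w Fin.zero) ++_) (φ^-concatFin m (w ∘ Fin.suc)) ⟩
    φ^ m (w Fin.zero) ++ concatFin (φ^ m ∘ w ∘ Fin.suc)
  ≡⟨ concatFin-suc (φ^ m ∘ w) ⟨
    concatFin (φ^ m ∘ w)
  ∎
  where open ≡-Reasoning

concatFin-φ^-factor : ∀ m {n} (s : Fin n → ℕ) (w : Fin n → Word) → (∀ j → m ≤ s j) →
  concatFin (λ j → φ^ (s j) (w j)) ≡ φ^ m (concatFin (λ j → φ^ (s j ∸ m) (w j)))
concatFin-φ^-factor m s w m≤s = trans
  (concatFin-cong (λ j → φ^-∸ (w j) (m≤s j)))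
  (sym (φ^-concatFin m (λ j → φ^ (s j ∸ m) (w j))))

count-concatFin : ∀ b {n} (w : Fin n → Word) →
  count b (concatFin w) ≡ sum +-0-commutativeMonoid (count b ∘ w)
count-concatFin b {zero}  w = refl
count-concatFin b {suc n} w = begin
    count b (concatFin w)
  ≡⟨ cong (count b) (concatFin-suc w) ⟩
    count b (w Fin.zero ++ concatFin (w ∘ Fin.suc))
  ≡⟨ count-++ b (w Fin.zero) _ ⟩
    count b (w Fin.zero) + count b (concatFin (w ∘ Fin.suc))
  ≡⟨ cong (count b (w Fin.zero) +_) (count-concatFin b (w ∘ Fin.suc)) ⟩
    count b (w Fin.zero) + sum +-0-commutativeMonoid (count b ∘ w ∘ Fin.suc)
  ∎
  where open ≡-Reasoning

count-concatFin-permute : ∀ b {n} (w w′ : Fin n → Word) (π : Permutation′ n) →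
  (∀ j → count b (w j) ≡ count b (w′ j)) →
  count b (concatFin w) ≡ count b (concatFin (w′ ∘ (π ⟨$⟩ʳ_)))
count-concatFin-permute b w w′ π counts = begin
  count b (concatFin w)                           ≡⟨ count-concatFin b w ⟩
  Σ (count b ∘ w)                                 ≡⟨ sum-permute +-0-commutativeMonoid (count b ∘ w) π ⟩
  Σ (count b ∘ w ∘ (π ⟨$⟩ʳ_))                     ≡⟨ sum-cong-≗ +-0-commutativeMonoid (counts ∘ (π ⟨$⟩ʳ_)) ⟩
  Σ (count b ∘ w′ ∘ (π ⟨$⟩ʳ_))                    ≡⟨ count-concatFin b (w′ ∘ (π ⟨$⟩ʳ_)) ⟨
  count b (concatFin (w′ ∘ (π ⟨$⟩ʳ_)))            ∎
  where
  open ≡-Reasoning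
  Σ = sum +-0-commutativeMonoid

corollary4p7 : (k n : ℕ) → 1 ≤ k → 2 ≤ n →
    (u : Fin n → Word) → (i : Fin n → ℕ) → (r : Fin n) →
    ((j : Fin n) → u j ≢ []) →
    i r ≡ k ∸ 1 →
    ((j : Fin n) → j ≢ r → k ≤ i j) →
    (ν : Permutation′ n) → (u′ : Fin n → Word) →
    ((j : Fin n) → length (u′ j) ≡ length (u j)) →
    u′ r ≡ u r →
    concatFin (λ j → φ^ (i j) (u j))
      ∼[ k ] concatFin (λ j → φ^ (i (ν ⟨$⟩ʳ j)) (u′ (ν ⟨$⟩ʳ j)))
corollary4p7 (suc m) n _ _ u i r _ ir≡m k≤i ν u′ |u′|≡|u| u′r≡ur = begin
    concatFin (λ j → φ^ (i j) (u j))             ≡⟨ concatFin-φ^-factor m i u m≤i ⟩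
    φ^ m (concatFin (blocks u))                  ≈⟨ φ^-↭ m (≡-counts⇒↭ counts) ⟩
    φ^ m (concatFin (blocks u′ ∘ π))             ≡⟨ concatFin-φ^-factor m (i ∘ π) (u′ ∘ π) (m≤i ∘ π) ⟨
    concatFin (λ j → φ^ (i (π j)) (u′ (π j)))    ∎
  where
  open ∼-Reasoning (suc m)
  π = ν ⟨$⟩ʳ_
  blocks : (Fin n → Word) → Fin n → Word
  blocks v j = φ^ (i j ∸ m) (v j)
  m≤i : ∀ j → m ≤ i j
  m≤i j with j Fin.≟ r
  ... | yes refl = ≤-reflexive (sym ir≡m)
  ... | no j≢r   = <⇒≤ (k≤i j j≢r)
  block-counts : ∀ b j → count b (blocks u j) ≡ count b (blocks u′ j)
  block-counts b j with j Fin.≟ r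
  ... | yes refl = cong (count b ∘ φ^ (i r ∸ m)) (sym u′r≡ur)
  ... | no j≢r   = count-φ^-cong b (m<n⇒0<n∸m (k≤i j j≢r)) (sym (|u′|≡|u| j))
  counts : ∀ b → count b (concatFin (blocks u)) ≡ count b (concatFin (blocks u′ ∘ π))
  counts b = count-concatFin-permute b (blocks u) (blocks u′) ν (block-counts b)
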